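{- Let $T$ be a finite alphabet. For all boundaries $X_i,Y_i,Z_i$ ($i=1,2$) and cowordisms $\sigma_i:X_i\to Y_i$, $\tau_i:Y_i\to Z_i$ over $T$, we have $(\tau_1\otimes\tau_2)\circ(\sigma_1\otimes\sigma_2)=(\tau_1\circ\sigma_1)\otimes(\tau_2\circ\sigma_2)$.
   Context: A boundary $X$ is a natural number $|X|$ with a subset $X_l\subseteq\{1,\dots,|X|\}$ (left endpoints); $X_r$ is the complement. $X\otimes Y$: $|X\otimes Y|=|X|+|Y|$, $(X\otimes Y)_l=X_l\cup\{|X|+i:i\in Y_l\}$; $X^\perp$: $|X^\perp|=|X|$, $(X^\perp)_l=\{|X|+1-i:i\in X_r\}$. A regular multiword with boundary $X$ over $T$ is a set of edges $(i,w,j)$, $w\in T^*$, forming a perfect matching of $\{1,\dots,|X|\}$, each edge from a left to a right endpoint. A multiword is a pair $(M_0,M_c)$ of a regular multiword and a finite multiset $M_c$ of cyclic words (words modulo cyclic permutation). A cowordism $\sigma:X\to Y$ is a multiword with boundary $Y\otimes X^\perp$. Composition of $\sigma:X\to Y,\tau:Y\to Z$: identify vertex $i$ of $\sigma$ with vertex $|Z|+|Y|+1-i$ of $\tau$ ($1\le i\le|Y|$); maximal paths between non-identified vertices become edges labelled by concatenation of labels along the path (vertex $j\le |Z|$ of $\tau$ keeps number $j$, vertex $|Y|+j$ of $\sigma$ becomes $|Z|+j$); closed cycles contribute their cyclic words; singular parts are added. Tensor of $\sigma:X\to Y$ and $\tau:Z\to W$: $\sigma\otimes\tau:X\otimes Z\to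 Y\otimes W$ is the multiword with boundary $Y\otimes W\otimes Z^\perp\otimes X^\perp$ consisting of the edges of $\sigma$ with vertex $i$ renumbered $i$ if $i\le|Y|$ and $i+|W|+|Z|$ otherwise, the edges of $\tau$ with all vertices shifted by $|Y|$, and singular part $\sigma_c+\tau_c$. -}

module Defs where

open import Data.Nat using (ℕ; zero; suc; _+_; _∸_; _≤ᵇ_; _≡ᵇ_)
open import Data.Bool using (Bool; true; false; not; if_then_else_; _∧_)
open import Data.Fin using (Fin; toℕ; splitAt; opposite)
open import Data.Sum using ([_,_])
open import Data.Product using (Σ; _×_; _,_; ∃₂)
open import Data.Maybe using (Maybe; just; nothing)
import Data.Maybe as Maybe
open import Data.List using (List; []; _∷_; _++_; map; mapMaybe; upTo; length)
open import Data.List.Relation.Unary.All using (All)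
open import Data.List.Relation.Binary.Permutation.Propositional using (_↭_)
open import Data.List.Relation.Binary.Permutation.Homogeneous using (Permutation)
open import Relation.Binary.PropositionalEquality using (_≡_)

-- A boundary X has a size |X| and a subset X_l of
-- {1,…,|X|}; position k : Fin |X| stands for the number toℕ k + 1,
-- and  left k ≡ true  means  toℕ k + 1 ∈ X_l.  X_r is the complement.

record Boundary : Set where
  constructor bnd
  field
    size : ℕ
    left : Fin size → Bool
open Boundary public

_⊗B_ : Boundary → Boundary → Boundary
X ⊗B Y = bnd (size X + size Y) (λ k → [ left X , left Y ] (splitAt (size X) k))

-- (X^⊥)_l = { |X|+1-i : i ∈ X_r }; opposite k encodes |X|+1-(toℕ k+1).
_⊥B : Boundary → Boundary
X ⊥B = bnd (size X) (λ k → not (left X (opposite k)))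

InL : Boundary → ℕ → Set
InL X i = Σ (Fin (size X)) λ k → (suc (toℕ k) ≡ i) × (left X k ≡ true)

InR : Boundary → ℕ → Set
InR X i = Σ (Fin (size X)) λ k → (suc (toℕ k) ≡ i) × (left X k ≡ false)

allB : (ℕ → Bool) → List ℕ → Bool
allB p [] = true
allB p (x ∷ xs) = p x ∧ allB p xs

Edge : Set → Set
Edge T = ℕ × List T × ℕ

record Multiword (T : Set) : Set where
  constructor mw
  field
    regular  : List (Edge T)       -- M₀ (a set of edges, as a list)
    singular : List (List T)       -- M_c (a multiset of cyclic words)
open Multiword public

endpoints : ∀ {T} → List (Edge T) → List ℕ
endpoints [] = []
endpoints ((i , _ , j) ∷ es) = i ∷ j ∷ endpoints es

range : ℕ → List ℕ
range n = map suc (upTo n)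

-- M is a multiword with boundary X: its regular part is a perfect matching
-- of {1,…,|X|} (the multiset of endpoints is exactly {1,…,|X|}), each edge
-- going from a left endpoint to a right endpoint.
IsMultiword : ∀ {T} → Boundary → Multiword T → Set
IsMultiword X M =
  All (λ { (i , _ , j) → InL X i × InR X j }) (regular M)
  × (endpoints (regular M) ↭ range (size X))

record Cowordism (T : Set) (X Y : Boundary) : Set where
  constructor cow
  field
    word  : Multiword T
    valid : IsMultiword (Y ⊗B (X ⊥B)) word
open Cowordism public

CycEq : ∀ {T} → List T → List T → Set
CycEq u v = ∃₂ λ a b → (u ≡ a ++ b) × (v ≡ b ++ a)

_≈M_ : ∀ {T} → Multiword T → Multiword T → Set
M ≈M N = (regular M ↭ regular N) × Permutation CycEq (singular M) (singular N)

-- Tensor.  σ : X → Y, τ : Z → W;  σ ⊗ τ has boundary Y⊗W⊗Z^⊥⊗X^⊥.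

tensorM : ∀ {T} → (X Y Z W : Boundary) → Multiword T → Multiword T → Multiword T
tensorM X Y Z W σ τ =
  mw (map renσ (regular σ) ++ map renτ (regular τ)) (singular σ ++ singular τ)
  where
  rσ : ℕ → ℕ
  rσ i = if i ≤ᵇ size Y then i else i + size W + size Z
  renσ : _ → _
  renσ (i , w , j) = (rσ i , w , rσ j)
  renτ : _ → _
  renτ (i , w , j) = (size Y + i , w , size Y + j)

-- Composition.  σ : X → Y, τ : Y → Z.  Vertices of the glued graph are
-- tagged by the multiword they come from.

data V : Set where
  vs : ℕ → V
  vt : ℕ → V

_==V_ : V → V → Bool
vs i ==V vs j = i ≡ᵇ j
vt i ==V vt j = i ≡ᵇ j
_    ==V _    = false

module Compose {T : Set} (Y Z : Boundary) (τ σ : Multiword T) where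

  y z : ℕ
  y = size Y
  z = size Z

  GEdge : Set
  GEdge = V × List T × V

  E : List GEdge
  E = map (λ { (i , w , j) → (vs i , w , vs j) }) (regular σ)
   ++ map (λ { (i , w , j) → (vt i , w , vt j) }) (regular τ)

  identified : V → Bool
  identified (vs i) = i ≤ᵇ y
  identified (vt j) = suc z ≤ᵇ j

  partner : V → V
  partner (vs i) = vt (z + y + 1 ∸ i)
  partner (vt j) = vs (z + y + 1 ∸ j)

  outer : V → ℕ
  outer (vt j) = j
  outer (vs i) = z + (i ∸ y)

  outEdge : List GEdge → V → Maybe (List T × V)
  outEdge [] v = nothing
  outEdge ((a , w , b) ∷ es) v = if a ==V v then just (w , b) else outEdge es v

  -- follow the path leaving v until a non-identified vertex is reached;
  -- the fuel (number of edges) bounds the length of any path.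
  walk : ℕ → V → Maybe (List T × V)
  walk zero v = nothing
  walk (suc f) v with outEdge E v
  ... | nothing = nothing
  ... | just (w , u) =
        if identified u
        then Maybe.map (λ { (w' , e) → (w ++ w' , e) }) (walk f (partner u))
        else just (w , u)

  pathEdge : GEdge → Maybe (Edge T)
  pathEdge (a , _ , _) =
    if identified a then nothing
    else Maybe.map (λ { (w , e) → (outer a , w , outer e) }) (walk (length E) a)

  σsrcs : V → List ℕ
  σsrcs (vs i) = i ∷ []
  σsrcs (vt _) = []

  cycleFrom : ℕ → V → V → Maybe (List T × List ℕ)
  cycleFrom zero st v = nothing
  cycleFrom (suc f) st v with outEdge E v
  ... | nothing = nothing
  ... | just (w , u) =
        if identified u
        then (if partner u ==V st
              then just (w , σsrcs v)
              else Maybe.map (λ { (w' , ns) → (w ++ w' , σsrcs v ++ ns) })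
                             (cycleFrom f st (partner u)))
        else nothing

  -- each closed cycle is counted once, from its σ-edge of least source
  cycleWord : GEdge → Maybe (List T)
  cycleWord (vt _ , _ , _) = nothing
  cycleWord (vs i , _ , _) with cycleFrom (length E) (vs i) (vs i)
  ... | nothing = nothing
  ... | just (w , ns) = if allB (i ≤ᵇ_) ns then just w else nothing

  result : Multiword T
  result = mw (mapMaybe pathEdge E)
              (singular σ ++ singular τ ++ mapMaybe cycleWord E)

-- τ ∘ σ  for σ : X → Y, τ : Y → Z  (only |Y|, |Z| matter)
composeM : ∀ {T} → (Y Z : Boundary) → Multiword T → Multiword T → Multiword T
composeM Y Z τ σ = Compose.result Y Z τ σ

module Submission where

-- The composite of the two tensors glues a graph which is the disjoint union
-- of the graphs glued by τ₁ ∘ σ₁ and by τ₂ ∘ σ₂: each factor embeds into it by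
-- a renumbering of vertices (the shifts used by ⊗ for the first factor,
-- adding |Y₁| or |Z₁| for the second), and these renumberings commute with
-- following an edge, with the identification of vertices and with the final
-- numbering. Hence every maximal path and every closed cycle of the big graph
-- is the image of exactly one in a factor. Because in-degrees are at most
-- one, walks never revisit a vertex, so the larger fuel of the big graph is
-- irrelevant. What remains is a reordering of edges and of cyclic words.

open import Defs
open import Algebra.Bundles using (CommutativeMonoid)
import Algebra.Properties.CommutativeSemigroup as CommutativeSemigroupProperties
open import Data.Bool using (true; false; if_then_else_; _∧_)
open import Data.Bool.Properties using (T-≡; ¬-not)
open import Data.Empty using (⊥-elim)
open import Data.Fin using (Fin; toℕ)
open import Data.Fin.Properties using (toℕ<n)
open import Data.List using (List; []; _∷_; _++_; map; mapMaybe; length)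
open import Data.List.Properties using (length-++; length-map; map-++; map-∘; map-cong; ++-identityʳ; mapMaybe-++; mapMaybe-map; map-mapMaybe)
open import Data.List.Membership.Propositional using (_∈_; _∉_)
open import Data.List.Membership.Propositional.Properties using (∈-∃++; ∈-map⁺; ∈-map⁻; ∈-++⁻; ∈-++⁺ˡ; ∈-++⁺ʳ)
open import Data.List.Relation.Binary.Subset.Propositional using (_⊆_)
open import Data.List.Relation.Unary.Any using (here; there)
open import Data.List.Relation.Unary.All using (All; []; _∷_)
import Data.List.Relation.Unary.All as All
open import Data.List.Relation.Unary.All.Properties using (¬Any⇒All¬)
import Data.List.Relation.Unary.AllPairs as AllPairs
open import Data.List.Relation.Unary.Unique.Propositional using (Unique; []; _∷_)
import Data.List.Relation.Unary.Unique.Propositional.Properties as Unique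
open import Data.List.Relation.Binary.Permutation.Propositional using (_↭_; ↭-sym; ↭-trans; ↭-reflexive; ↭⇒↭ₛ)
open import Data.List.Relation.Binary.Permutation.Propositional.Properties using (++-commutativeMonoid; ++⁺ˡ; ↭-length; mapMaybe-↭)
import Data.List.Relation.Binary.Permutation.Setoid.Properties as SetoidPermutation
open import Data.List.Relation.Binary.Permutation.Homogeneous using (Permutation)
import Data.List.Relation.Binary.Permutation.Homogeneous as Homogeneous
open import Data.Maybe using (Maybe; just; nothing; _<∣>_)
import Data.Maybe as Maybe
open import Data.Maybe.Properties using (<∣>-identityʳ)
open import Data.Nat using (ℕ; zero; suc; _+_; _∸_; _≤ᵇ_; _≡ᵇ_; _≤_; _<_; s≤s; z≤n)
open import Data.Nat.Properties
open import Data.Nat.Tactic.RingSolver using (solve-∀)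
open import Data.Product using (Σ; _×_; _,_; proj₁; proj₂; map₂)
open import Data.Sum using (_⊎_; inj₁; inj₂)
open import Data.Unit using (⊤; tt)
open import Function using (_∘_; id)
open import Function.Bundles using (Equivalence; _⇔_; mk⇔)
open import Relation.Binary.PropositionalEquality
open import Relation.Nullary using (yes; no; contradiction)
open import Relation.Nullary.Decidable using (does-⇔)

≤⇒≤ᵇ≡true : ∀ {m n} → m ≤ n → (m ≤ᵇ n) ≡ true
≤⇒≤ᵇ≡true m≤n = Equivalence.to T-≡ (≤⇒≤ᵇ m≤n)

≤ᵇ≡true⇒≤ : ∀ {m n} → (m ≤ᵇ n) ≡ true → m ≤ n
≤ᵇ≡true⇒≤ {m} {n} e = ≤ᵇ⇒≤ m n (Equivalence.from T-≡ e)

>⇒≤ᵇ≡false : ∀ {m n} → n < m → (m ≤ᵇ n) ≡ false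
>⇒≤ᵇ≡false n<m = ¬-not (λ e → <⇒≱ n<m (≤ᵇ≡true⇒≤ e))

≤ᵇ≡false⇒> : ∀ {m n} → (m ≤ᵇ n) ≡ false → n < m
≤ᵇ≡false⇒> e = ≰⇒> (λ m≤n → contradiction (trans (sym e) (≤⇒≤ᵇ≡true m≤n)) λ ())

≤ᵇ-cong : ∀ {a b c d} → (a ≤ b ⇔ c ≤ d) → (a ≤ᵇ b) ≡ (c ≤ᵇ d)
≤ᵇ-cong {a} {b} {c} {d} a≤b⇔c≤d = does-⇔ a≤b⇔c≤d (a ≤? b) (c ≤? d)

≡ᵇ-cong : ∀ {a b c d} → (a ≡ b ⇔ c ≡ d) → (a ≡ᵇ b) ≡ (c ≡ᵇ d)
≡ᵇ-cong {a} {b} {c} {d} a≡b⇔c≡d = does-⇔ a≡b⇔c≡d (a ≟ b) (c ≟ d)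

≤ᵇ-preserving⇒injective : ∀ (f : ℕ → ℕ) → (∀ a b → (f a ≤ᵇ f b) ≡ (a ≤ᵇ b)) →
                          ∀ {a b} → f a ≡ f b → a ≡ b
≤ᵇ-preserving⇒injective f f-≤ᵇ {a} {b} fa≡fb = ≤-antisym (reflect a b fa≡fb) (reflect b a (sym fa≡fb))
  where
  reflect : ∀ a b → f a ≡ f b → a ≤ b
  reflect a b e = ≤ᵇ≡true⇒≤ (trans (sym (f-≤ᵇ a b)) (≤⇒≤ᵇ≡true (≤-reflexive e)))

==V⇒≡ : ∀ u v → (u ==V v) ≡ true → u ≡ v
==V⇒≡ (vs i) (vs j) e = cong vs (≡ᵇ⇒≡ i j (Equivalence.from T-≡ e))
==V⇒≡ (vt i) (vt j) e = cong vt (≡ᵇ⇒≡ i j (Equivalence.from T-≡ e))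

==V-refl : ∀ v → (v ==V v) ≡ true
==V-refl (vs i) = Equivalence.to T-≡ (≡⇒≡ᵇ i i refl)
==V-refl (vt i) = Equivalence.to T-≡ (≡⇒≡ᵇ i i refl)

vs-injective : ∀ {m n} → vs m ≡ vs n → m ≡ n
vs-injective refl = refl

vt-injective : ∀ {m n} → vt m ≡ vt n → m ≡ n
vt-injective refl = refl

≢⇒==V≡false : ∀ {u v} → u ≢ v → (u ==V v) ≡ false
≢⇒==V≡false u≢v = ¬-not (λ e → u≢v (==V⇒≡ _ _ e))

==V≡false⇒≢ : ∀ {u v} → (u ==V v) ≡ false → u ≢ v
==V≡false⇒≢ {u} e refl = contradiction (trans (sym e) (==V-refl u)) λ ()

shiftAbove : ℕ → ℕ → ℕ → ℕ → ℕ
shiftAbove c p q i = if i ≤ᵇ c then i else i + p + q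

module _ (c p q : ℕ) where

  shiftAbove-≤ : ∀ {i} → i ≤ c → shiftAbove c p q i ≡ i
  shiftAbove-≤ i≤c rewrite ≤⇒≤ᵇ≡true i≤c = refl

  shiftAbove-> : ∀ {i} → c < i → shiftAbove c p q i ≡ i + p + q
  shiftAbove-> c<i rewrite >⇒≤ᵇ≡false c<i = refl

  ≤-+p+q : ∀ i → i ≤ i + p + q
  ≤-+p+q i = ≤-trans (m≤m+n i p) (m≤m+n (i + p) q)

  shiftAbove-≤-⇔ : ∀ a b → shiftAbove c p q a ≤ shiftAbove c p q b ⇔ a ≤ b
  shiftAbove-≤-⇔ a b with a ≤? c | b ≤? c
  ... | yes a≤c | yes b≤c rewrite shiftAbove-≤ a≤c | shiftAbove-≤ b≤c = mk⇔ id id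
  ... | yes a≤c | no b≰c rewrite shiftAbove-≤ a≤c | shiftAbove-> (≰⇒> b≰c) =
    mk⇔ (λ _ → a≤b) (λ _ → ≤-trans a≤b (≤-+p+q b))
    where a≤b = ≤-trans a≤c (<⇒≤ (≰⇒> b≰c))
  ... | no a≰c | yes b≤c rewrite shiftAbove-> (≰⇒> a≰c) | shiftAbove-≤ b≤c =
    mk⇔ (λ a+p+q≤b → ⊥-elim (b≱a (≤-trans (≤-+p+q a) a+p+q≤b))) (λ a≤b → ⊥-elim (b≱a a≤b))
    where b≱a = <⇒≱ (≤-<-trans b≤c (≰⇒> a≰c))
  ... | no a≰c | no b≰c rewrite shiftAbove-> (≰⇒> a≰c) | shiftAbove-> (≰⇒> b≰c) =
    mk⇔ (λ le → +-cancelʳ-≤ p a b (+-cancelʳ-≤ q (a + p) (b + p) le))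
        (λ a≤b → +-monoˡ-≤ q (+-monoˡ-≤ p a≤b))

  shiftAbove≤c+p⇔ : ∀ i → shiftAbove c p q i ≤ c + p ⇔ i ≤ c
  shiftAbove≤c+p⇔ i with i ≤? c
  ... | yes i≤c rewrite shiftAbove-≤ i≤c = mk⇔ (λ _ → i≤c) (λ _ → ≤-trans i≤c (m≤m+n c p))
  ... | no i≰c rewrite shiftAbove-> (≰⇒> i≰c) =
    mk⇔ (λ le → ⊥-elim (<⇒≱ (+-monoˡ-< p (≰⇒> i≰c)) (≤-trans (m≤m+n (i + p) q) le)))
        (λ i≤c → ⊥-elim (i≰c i≤c))

  c+p<shiftAbove⇔ : ∀ i → c + p < shiftAbove c p q i ⇔ c < i
  c+p<shiftAbove⇔ i = mk⇔ (λ lt → ≰⇒> (λ i≤c → <⇒≱ lt (Equivalence.from (shiftAbove≤c+p⇔ i) i≤c)))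
                          (λ c<i → ≰⇒> (λ le → <⇒≱ c<i (Equivalence.to (shiftAbove≤c+p⇔ i) le)))

  shiftAbove-≤ᵇ : ∀ a b → (shiftAbove c p q a ≤ᵇ shiftAbove c p q b) ≡ (a ≤ᵇ b)
  shiftAbove-≤ᵇ a b = ≤ᵇ-cong (shiftAbove-≤-⇔ a b)

  shiftAbove-injective : ∀ {a b} → shiftAbove c p q a ≡ shiftAbove c p q b → a ≡ b
  shiftAbove-injective = ≤ᵇ-preserving⇒injective (shiftAbove c p q) shiftAbove-≤ᵇ

  c+≢shiftAbove : ∀ {j} i → 1 ≤ j → j ≤ p + q → c + j ≢ shiftAbove c p q i
  c+≢shiftAbove {j} i 1≤j j≤p+q e with i ≤? c
  ... | yes i≤c = <⇒≢ (≤-<-trans i≤c (m<m+n c 1≤j)) (sym (trans e (shiftAbove-≤ i≤c)))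
  ... | no i≰c = <⇒≢ c+j<i+p+q (trans e (shiftAbove-> (≰⇒> i≰c)))
    where
    open ≤-Reasoning
    c+j<i+p+q : c + j < i + p + q
    c+j<i+p+q = begin-strict
      c + j      ≤⟨ +-monoʳ-≤ c j≤p+q ⟩
      c + (p + q) ≡⟨ +-assoc c p q ⟨
      c + p + q  <⟨ +-monoˡ-< q (+-monoˡ-< p (≰⇒> i≰c)) ⟩
      i + p + q  ∎

∈-delete : ∀ {X : Set} {z x : X} as {bs} → z ≢ x → z ∈ as ++ x ∷ bs → z ∈ as ++ bs
∈-delete as z≢x z∈ with ∈-++⁻ as z∈
... | inj₁ z∈as = ∈-++⁺ˡ z∈as
... | inj₂ (here z≡x) = contradiction z≡x z≢x
... | inj₂ (there z∈bs) = ∈-++⁺ʳ as z∈bs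

Unique-⊆⇒length≤ : ∀ {X : Set} {xs ys : List X} → Unique xs → xs ⊆ ys → length xs ≤ length ys
Unique-⊆⇒length≤ [] _ = z≤n
Unique-⊆⇒length≤ {xs = x ∷ xs} (x∉xs ∷ xs-unique) x∷xs⊆ys with ∈-∃++ (x∷xs⊆ys (here refl))
... | as , bs , refl = begin
  suc (length xs)             ≤⟨ s≤s (Unique-⊆⇒length≤ xs-unique xs⊆as++bs) ⟩
  suc (length (as ++ bs))     ≡⟨ cong suc (length-++ as) ⟩
  suc (length as + length bs) ≡⟨ +-suc (length as) (length bs) ⟨
  length as + length (x ∷ bs) ≡⟨ length-++ as ⟨
  length (as ++ x ∷ bs)       ∎
  where
  open ≤-Reasoning
  xs⊆as++bs : xs ⊆ as ++ bs
  xs⊆as++bs z∈xs = ∈-delete as (≢-sym (All.lookup x∉xs z∈xs)) (x∷xs⊆ys (there z∈xs))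

Unique-resp-↭ : ∀ {X : Set} {xs ys : List X} → xs ↭ ys → Unique xs → Unique ys
Unique-resp-↭ {X} xs↭ys = SetoidPermutation.Unique-resp-↭ (setoid X) (↭⇒↭ₛ xs↭ys)

mapMaybe-cong-∈ : ∀ {X Z : Set} (f g : X → Maybe Z) xs →
                  (∀ {x} → x ∈ xs → f x ≡ g x) → mapMaybe f xs ≡ mapMaybe g xs
mapMaybe-cong-∈ f g [] _ = refl
mapMaybe-cong-∈ f g (x ∷ xs) f≗g with f x | g x | f≗g (here refl)
... | just z | .(just z) | refl = cong (z ∷_) (mapMaybe-cong-∈ f g xs (f≗g ∘ there))
... | nothing | .nothing | refl = mapMaybe-cong-∈ f g xs (f≗g ∘ there)

↭-interchange : ∀ {X : Set} (a b c d : List X) → (a ++ b) ++ (c ++ d) ↭ (a ++ c) ++ (b ++ d)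
↭-interchange {X} = CommutativeSemigroupProperties.interchange
  (CommutativeMonoid.commutativeSemigroup (++-commutativeMonoid {A = X}))

↭-interchange₃ : ∀ {X : Set} (a₁ a₂ b₁ b₂ c₁ c₂ : List X) →
  (a₁ ++ a₂) ++ ((b₁ ++ b₂) ++ (c₁ ++ c₂)) ↭ (a₁ ++ (b₁ ++ c₁)) ++ (a₂ ++ (b₂ ++ c₂))
↭-interchange₃ a₁ a₂ b₁ b₂ c₁ c₂ =
  ↭-trans (++⁺ˡ (a₁ ++ a₂) (↭-interchange b₁ b₂ c₁ c₂)) (↭-interchange a₁ a₂ (b₁ ++ c₁) (b₂ ++ c₂))

map-∘-cong : ∀ {X Y Y' W : Set} {g : Y → W} {f : X → Y} {g' : Y' → W} {f' : X → Y'} xs →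
             (∀ x → g (f x) ≡ g' (f' x)) → map g (map f xs) ≡ map g' (map f' xs)
map-∘-cong xs g∘f≗g'∘f' = trans (sym (map-∘ xs)) (trans (map-cong g∘f≗g'∘f' xs) (map-∘ xs))

cyclic-refl : ∀ {X : Set} (u : List X) → CycEq u u
cyclic-refl u = u , [] , sym (++-identityʳ u) , refl

↭⇒cyclic-↭ : ∀ {X : Set} {us ws : List (List X)} → us ↭ ws → Permutation CycEq us ws
↭⇒cyclic-↭ us↭ws = Homogeneous.map (λ { {u} refl → cyclic-refl u }) (↭⇒↭ₛ us↭ws)

module GluingGraph {A : Set} (Y Z : Boundary) (τ σ : Multiword A) where
  open Compose Y Z τ σ

  outEdge-∈ : ∀ es v {w u} → outEdge es v ≡ just (w , u) → (v , w , u) ∈ es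
  outEdge-∈ ((a , w , b) ∷ es) v eq with a ==V v in a==v
  ... | true with refl ← eq = here (cong (λ x → x , w , b) (sym (==V⇒≡ a v a==v)))
  ... | false = there (outEdge-∈ es v eq)

  σ-edges τ-edges : List GEdge
  σ-edges = map (λ { (i , w , j) → (vs i , w , vs j) }) (regular σ)
  τ-edges = map (λ { (i , w , j) → (vt i , w , vt j) }) (regular τ)

  outEdge-++ : ∀ xs ys v → outEdge (xs ++ ys) v ≡ (outEdge xs v <∣> outEdge ys v)
  outEdge-++ [] ys v = refl
  outEdge-++ ((a , w , b) ∷ xs) ys v with a ==V v
  ... | true = refl
  ... | false = outEdge-++ xs ys v

  outEdge-map-∉ : ∀ {X : Set} (f : X → GEdge) xs v → (∀ {x} → x ∈ xs → proj₁ (f x) ≢ v) →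
                  outEdge (map f xs) v ≡ nothing
  outEdge-map-∉ f [] v _ = refl
  outEdge-map-∉ f (x ∷ xs) v ∉ rewrite ≢⇒==V≡false (∉ (here refl)) = outEdge-map-∉ f xs v (∉ ∘ there)

  module _ (a b c d : List GEdge) (v : V) where
    open ≡-Reasoning

    private
      outEdge-++-++ : outEdge ((a ++ b) ++ (c ++ d)) v
                      ≡ ((outEdge a v <∣> outEdge b v) <∣> (outEdge c v <∣> outEdge d v))
      outEdge-++-++ = trans (outEdge-++ (a ++ b) (c ++ d) v) (cong₂ _<∣>_ (outEdge-++ a b v) (outEdge-++ c d v))

    outEdge-interleaveˡ : outEdge b v ≡ nothing → outEdge d v ≡ nothing →
                          outEdge ((a ++ b) ++ (c ++ d)) v ≡ outEdge (a ++ c) v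
    outEdge-interleaveˡ b∌v d∌v = begin
      outEdge ((a ++ b) ++ (c ++ d)) v
        ≡⟨ outEdge-++-++ ⟩
      (outEdge a v <∣> outEdge b v) <∣> (outEdge c v <∣> outEdge d v)
        ≡⟨ cong₂ (λ p q → (outEdge a v <∣> p) <∣> (outEdge c v <∣> q)) b∌v d∌v ⟩
      (outEdge a v <∣> nothing) <∣> (outEdge c v <∣> nothing)
        ≡⟨ cong₂ _<∣>_ (<∣>-identityʳ (outEdge a v)) (<∣>-identityʳ (outEdge c v)) ⟩
      outEdge a v <∣> outEdge c v
        ≡⟨ outEdge-++ a c v ⟨
      outEdge (a ++ c) v ∎

    outEdge-interleaveʳ : outEdge a v ≡ nothing → outEdge c v ≡ nothing →
                          outEdge ((a ++ b) ++ (c ++ d)) v ≡ outEdge (b ++ d) v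
    outEdge-interleaveʳ a∌v c∌v = begin
      outEdge ((a ++ b) ++ (c ++ d)) v
        ≡⟨ outEdge-++-++ ⟩
      (outEdge a v <∣> outEdge b v) <∣> (outEdge c v <∣> outEdge d v)
        ≡⟨ cong₂ (λ p q → (p <∣> outEdge b v) <∣> (q <∣> outEdge d v)) a∌v c∌v ⟩
      outEdge b v <∣> outEdge d v
        ≡⟨ outEdge-++ b d v ⟨
      outEdge (b ++ d) v ∎

  data EdgeOf : GEdge → Set where
    σ-edge : ∀ {i w j} → (i , w , j) ∈ regular σ → EdgeOf (vs i , w , vs j)
    τ-edge : ∀ {i w j} → (i , w , j) ∈ regular τ → EdgeOf (vt i , w , vt j)

  edgeOf : ∀ {e} → e ∈ E → EdgeOf e
  edgeOf e∈ with ∈-++⁻ (map _ (regular σ)) e∈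
  ... | inj₁ e∈σ with (i , w , j) , e∈ , refl ← ∈-map⁻ _ e∈σ = σ-edge e∈
  ... | inj₂ e∈τ with (i , w , j) , e∈ , refl ← ∈-map⁻ _ e∈τ = τ-edge e∈

  private
    z+y+1≡1+z+y : z + y + 1 ≡ suc (z + y)
    z+y+1≡1+z+y = +-comm (z + y) 1

    y≤z+y+1 : y ≤ z + y + 1
    y≤z+y+1 = ≤-trans (m≤n+m y z) (m≤m+n (z + y) 1)

  identified-partner : ∀ u → identified u ≡ true → identified (partner u) ≡ true
  identified-partner (vs i) iu = ≤⇒≤ᵇ≡true (m+n≤o⇒m≤o∸n (suc z) (begin
    suc z + i     ≤⟨ s≤s (+-monoʳ-≤ z (≤ᵇ≡true⇒≤ iu)) ⟩
    suc (z + y)   ≡⟨ z+y+1≡1+z+y ⟨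
    z + y + 1     ∎))
    where open ≤-Reasoning
  identified-partner (vt j) iu = ≤⇒≤ᵇ≡true (begin
    z + y + 1 ∸ j       ≤⟨ ∸-monoʳ-≤ (z + y + 1) (≤ᵇ≡true⇒≤ {suc z} {j} iu) ⟩
    z + y + 1 ∸ suc z   ≡⟨ cong (_∸ suc z) z+y+1≡1+z+y ⟩
    z + y ∸ z           ≡⟨ m+n∸m≡n z y ⟩
    y                   ∎)
    where open ≤-Reasoning

  -- partner is injective on identified σ-vertices (which are ≤ |Y|), but on
  -- τ-vertices only up to |Z| + |Y|, because ∸ truncates
  InRange : V → Set
  InRange (vs _) = ⊤
  InRange (vt j) = j ≤ z + y

  partner-injective : ∀ {u u'} → identified u ≡ true → identified u' ≡ true →
                      InRange u → InRange u' → partner u ≡ partner u' → u ≡ u'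
  partner-injective {vs i} {vs i'} iu iu' _ _ e =
    cong vs (∸-cancelˡ-≡ (≤-trans (≤ᵇ≡true⇒≤ iu) y≤z+y+1) (≤-trans (≤ᵇ≡true⇒≤ iu') y≤z+y+1) (vt-injective e))
  partner-injective {vt j} {vt j'} _ _ j≤ j'≤ e =
    cong vt (∸-cancelˡ-≡ (≤-trans j≤ (m≤m+n (z + y) 1)) (≤-trans j'≤ (m≤m+n (z + y) 1)) (vs-injective e))

  walk-ends-unidentified : ∀ f v {w e} → walk f v ≡ just (w , e) → identified e ≡ false
  walk-ends-unidentified (suc f) v eq with outEdge E v
  ... | just (w , u) with identified u in iu
  ... | false with refl ← eq = iu
  ... | true with walk f (partner u) in we
  ... | just _ with refl ← eq = walk-ends-unidentified f (partner u) we

  -- When in-degrees are at most one, a walk never revisits a vertex, so it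
  -- ends within |E| steps and extra fuel changes nothing.
  module Fuel
    (in-degree≤1 : ∀ {x x' w w' u} → (x , w , u) ∈ E → (x' , w' , u) ∈ E → x ≡ x')
    (targets-in-range : ∀ {x w u} → (x , w , u) ∈ E → InRange u)
    where

    Step : V → V → Set
    Step x x' = Σ (List A) λ w → Σ V λ u →
      (outEdge E x ≡ just (w , u)) × (identified u ≡ true) × (partner u ≡ x')

    Step-injective : ∀ {x x' x''} → Step x x'' → Step x' x'' → x ≡ x'
    Step-injective (_ , _ , e , iu , p) (_ , _ , e' , iu' , p')
      with refl ← partner-injective iu iu' (targets-in-range (outEdge-∈ E _ e))
                    (targets-in-range (outEdge-∈ E _ e')) (trans p (sym p'))
      = in-degree≤1 (outEdge-∈ E _ e) (outEdge-∈ E _ e')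

    Linked : V → List V → V → Set
    Linked a S x = x ≡ a ⊎ Σ V λ s → s ∈ S × Step s x

    -- a walk from a that has visited S (most recent first) and is now at v
    record Trail (a : V) (S : List V) (v : V) : Set where
      field
        distinct : Unique (v ∷ S)
        sources  : All (_∈ map proj₁ E) S
        linked   : All (Linked a S) (v ∷ S)

    trail-start : ∀ a → Trail a [] a
    trail-start a = record { distinct = [] ∷ [] ; sources = [] ; linked = inj₁ refl ∷ [] }

    trail-extend : ∀ {a S v w u} → Trail a S v → outEdge E v ≡ just (w , u) →
                   identified u ≡ true → partner u ≢ a → Trail a (v ∷ S) (partner u)
    trail-extend {a} {S} {v} {w} {u} t eq iu u'≢a = record
      { distinct = ¬Any⇒All¬ (v ∷ S) new ∷ Trail.distinct t
      ; sources  = ∈-map⁺ proj₁ (outEdge-∈ E v eq) ∷ Trail.sources t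
      ; linked   = inj₂ (v , here refl , step) ∷ All.map weaken (Trail.linked t)
      }
      where
      step : Step v (partner u)
      step = w , u , eq , iu , refl
      weaken : ∀ {x} → Linked a S x → Linked a (v ∷ S) x
      weaken (inj₁ x≡a) = inj₁ x≡a
      weaken (inj₂ (s , s∈S , st)) = inj₂ (s , there s∈S , st)
      new : partner u ∉ v ∷ S
      new u'∈ with All.lookup (Trail.linked t) u'∈
      ... | inj₁ u'≡a = u'≢a u'≡a
      ... | inj₂ (s , s∈S , st) with refl ← Step-injective st step =
        All.lookup (AllPairs.head (Trail.distinct t)) s∈S refl

    trail-shorter : ∀ {a S v w u} → Trail a S v → outEdge E v ≡ just (w , u) → length S < length E
    trail-shorter {S = S} {v} t eq = subst (length S <_) (length-map proj₁ E)
      (Unique-⊆⇒length≤ (Trail.distinct t) (All.lookup (∈-map⁺ proj₁ (outEdge-∈ E v eq) ∷ Trail.sources t)))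

    walk-+ : ∀ {a} f {S v} d → Trail a S v → identified a ≡ false →
             f + length S ≡ length E → walk f v ≡ walk (f + d) v
    walk-+ zero zero _ _ _ = refl
    walk-+ zero {S} {v} (suc d) t _ f+|S|≡|E| with outEdge E v in eq
    ... | nothing = refl
    ... | just _ = contradiction f+|S|≡|E| (<⇒≢ (trail-shorter t eq))
    walk-+ (suc f) {S} {v} d t ia f+|S|≡|E| with outEdge E v in eq
    ... | nothing = refl
    ... | just (w , u) with identified u in iu
    ... | false = refl
    ... | true = cong (Maybe.map _) (walk-+ f d (trail-extend t eq iu u'≢a) ia
                                       (trans (+-suc f (length S)) f+|S|≡|E|))
      where
      u'≢a : partner u ≢ _
      u'≢a refl = contradiction (trans (sym (identified-partner u iu)) ia) λ ()

    cycleFrom-+ : ∀ {a} f {S v} d → Trail a S v →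
                  f + length S ≡ length E → cycleFrom f a v ≡ cycleFrom (f + d) a v
    cycleFrom-+ zero zero _ _ = refl
    cycleFrom-+ zero {S} {v} (suc d) t f+|S|≡|E| with outEdge E v in eq
    ... | nothing = refl
    ... | just _ = contradiction f+|S|≡|E| (<⇒≢ (trail-shorter t eq))
    cycleFrom-+ {a} (suc f) {S} {v} d t f+|S|≡|E| with outEdge E v in eq
    ... | nothing = refl
    ... | just (w , u) with identified u in iu
    ... | false = refl
    ... | true with partner u ==V a in u'==a
    ... | true = refl
    ... | false = cong (Maybe.map _) (cycleFrom-+ f d (trail-extend t eq iu (==V≡false⇒≢ u'==a))
                                        (trans (+-suc f (length S)) f+|S|≡|E|))

    walk-saturated : ∀ a → identified a ≡ false → ∀ {n} → length E ≤ n → walk n a ≡ walk (length E) a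
    walk-saturated a ia {n} |E|≤n = begin
      walk n a
        ≡⟨ cong (λ f → walk f a) (m+[n∸m]≡n |E|≤n) ⟨
      walk (length E + (n ∸ length E)) a
        ≡⟨ walk-+ (length E) (n ∸ length E) (trail-start a) ia (+-identityʳ _) ⟨
      walk (length E) a ∎
      where open ≡-Reasoning

    cycleFrom-saturated : ∀ a {n} → length E ≤ n → cycleFrom n a a ≡ cycleFrom (length E) a a
    cycleFrom-saturated a {n} |E|≤n = begin
      cycleFrom n a a
        ≡⟨ cong (λ f → cycleFrom f a a) (m+[n∸m]≡n |E|≤n) ⟨
      cycleFrom (length E + (n ∸ length E)) a a
        ≡⟨ cycleFrom-+ (length E) (n ∸ length E) (trail-start a) (+-identityʳ _) ⟨
      cycleFrom (length E) a a ∎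
      where open ≡-Reasoning

renumber : ∀ {A : Set} → (ℕ → ℕ) → Edge A → Edge A
renumber ρ (i , w , j) = (ρ i , w , ρ j)

allB-≤ᵇ-map : ∀ (r : ℕ → ℕ) → (∀ a b → (r a ≤ᵇ r b) ≡ (a ≤ᵇ b)) →
              ∀ i ns → allB (r i ≤ᵇ_) (map r ns) ≡ allB (i ≤ᵇ_) ns
allB-≤ᵇ-map r r-≤ᵇ i [] = refl
allB-≤ᵇ-map r r-≤ᵇ i (n ∷ ns) = cong₂ _∧_ (r-≤ᵇ i n) (allB-≤ᵇ-map r r-≤ᵇ i ns)

-- ι renumbers the gluing graph S into L; it only has to commute with the
-- graph structure on Inside, a set of vertices closed under following walks.
module Simulation {A : Set} (Y Z Y' Z' : Boundary) (τ σ τ' σ' : Multiword A)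
  (r rt ρ : ℕ → ℕ)
  (r-≤ᵇ : ∀ a b → (r a ≤ᵇ r b) ≡ (a ≤ᵇ b))
  (rt-injective : ∀ {a b} → rt a ≡ rt b → a ≡ b)
  (Inside : V → Set) where

  module S = Compose Y Z τ σ
  module L = Compose Y' Z' τ' σ'

  ι : V → V
  ι (vs i) = vs (r i)
  ι (vt j) = vt (rt j)

  ιE : S.GEdge → S.GEdge
  ιE (a , w , b) = (ι a , w , ι b)

  ==V-ι : ∀ u v → (ι u ==V ι v) ≡ (u ==V v)
  ==V-ι (vs i) (vs j) = ≡ᵇ-cong (mk⇔ (≤ᵇ-preserving⇒injective r r-≤ᵇ) (cong r))
  ==V-ι (vt i) (vt j) = ≡ᵇ-cong (mk⇔ rt-injective (cong rt))
  ==V-ι (vs i) (vt j) = refl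
  ==V-ι (vt i) (vs j) = refl

  outEdge-ι : ∀ es v → L.outEdge (map ιE es) (ι v) ≡ Maybe.map (map₂ ι) (S.outEdge es v)
  outEdge-ι [] v = refl
  outEdge-ι ((a , w , b) ∷ es) v rewrite ==V-ι a v with a ==V v
  ... | true = refl
  ... | false = outEdge-ι es v

  record IsSimulation : Set where
    field
      outEdge-E-ι    : ∀ v → Inside v → L.outEdge L.E (ι v) ≡ Maybe.map (map₂ ι) (S.outEdge S.E v)
      identified-ι   : ∀ v → L.identified (ι v) ≡ S.identified v
      partner-ι      : ∀ u → Inside u → S.identified u ≡ true → L.partner (ι u) ≡ ι (S.partner u)
      outer-ι        : ∀ v → S.identified v ≡ false → L.outer (ι v) ≡ ρ (S.outer v)
      target-inside  : ∀ {v w u} → S.outEdge S.E v ≡ just (w , u) → Inside u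
      partner-inside : ∀ {u} → Inside u → S.identified u ≡ true → Inside (S.partner u)

  -- the saturation hypotheses account for S being run with fuel |E_S| but L with |E_L|
  module Transport (sim : IsSimulation)
    (walks-saturate : ∀ a → S.identified a ≡ false → S.walk (length L.E) a ≡ S.walk (length S.E) a)
    (cycles-saturate : ∀ a → S.cycleFrom (length L.E) a a ≡ S.cycleFrom (length S.E) a a) where
    open IsSimulation sim

    walk-ι : ∀ f v → Inside v → L.walk f (ι v) ≡ Maybe.map (map₂ ι) (S.walk f v)
    walk-ι zero v _ = refl
    walk-ι (suc f) v v-in rewrite outEdge-E-ι v v-in with S.outEdge S.E v in eq
    ... | nothing = refl
    ... | just (w , u) rewrite identified-ι u with S.identified u in iu
    ... | false = refl
    ... | true rewrite partner-ι u (target-inside eq) iu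
                     | walk-ι f (S.partner u) (partner-inside (target-inside eq) iu)
                     with S.walk f (S.partner u)
    ... | nothing = refl
    ... | just _ = refl

    σsrcs-ι : ∀ v → L.σsrcs (ι v) ≡ map r (S.σsrcs v)
    σsrcs-ι (vs i) = refl
    σsrcs-ι (vt j) = refl

    cycleFrom-ι : ∀ f a v → Inside v →
                  L.cycleFrom f (ι a) (ι v) ≡ Maybe.map (map₂ (map r)) (S.cycleFrom f a v)
    cycleFrom-ι zero a v _ = refl
    cycleFrom-ι (suc f) a v v-in rewrite outEdge-E-ι v v-in with S.outEdge S.E v in eq
    ... | nothing = refl
    ... | just (w , u) rewrite identified-ι u with S.identified u in iu
    ... | false = refl
    ... | true rewrite partner-ι u (target-inside eq) iu | ==V-ι (S.partner u) a
                 with S.partner u ==V a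
    ... | true rewrite σsrcs-ι v = refl
    ... | false rewrite cycleFrom-ι f a (S.partner u) (partner-inside (target-inside eq) iu)
                  with S.cycleFrom f a (S.partner u)
    ... | nothing = refl
    ... | just (_ , ns) rewrite σsrcs-ι v | map-++ r (S.σsrcs v) ns = refl

    pathEdge-ι : ∀ e → Inside (proj₁ e) → L.pathEdge (ιE e) ≡ Maybe.map (renumber ρ) (S.pathEdge e)
    pathEdge-ι (a , _ , _) a-in rewrite identified-ι a with S.identified a in ia
    ... | true = refl
    ... | false rewrite walk-ι (length L.E) a a-in | walks-saturate a ia with S.walk (length S.E) a in wa
    ... | nothing = refl
    ... | just (_ , e) rewrite outer-ι a ia
                             | outer-ι e (GluingGraph.walk-ends-unidentified Y Z τ σ (length S.E) a wa) = refl

    cycleWord-ι : ∀ e → Inside (proj₁ e) → L.cycleWord (ιE e) ≡ S.cycleWord e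
    cycleWord-ι (vt _ , _ , _) _ = refl
    cycleWord-ι (vs i , _ , _) i-in
      rewrite cycleFrom-ι (length L.E) (vs i) (vs i) i-in | cycles-saturate (vs i)
      with S.cycleFrom (length S.E) (vs i) (vs i)
    ... | nothing = refl
    ... | just (_ , ns) rewrite allB-≤ᵇ-map r r-≤ᵇ i ns = refl

    module _ (es : List S.GEdge) (sources-inside : ∀ {e} → e ∈ es → Inside (proj₁ e)) where
      open ≡-Reasoning

      mapMaybe-pathEdge-ι : mapMaybe L.pathEdge (map ιE es) ≡ map (renumber ρ) (mapMaybe S.pathEdge es)
      mapMaybe-pathEdge-ι = begin
        mapMaybe L.pathEdge (map ιE es)
          ≡⟨ mapMaybe-map L.pathEdge ιE es ⟩
        mapMaybe (L.pathEdge ∘ ιE) es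
          ≡⟨ mapMaybe-cong-∈ _ _ es (λ {e} e∈ → pathEdge-ι e (sources-inside e∈)) ⟩
        mapMaybe (Maybe.map (renumber ρ) ∘ S.pathEdge) es
          ≡⟨ map-mapMaybe (renumber ρ) S.pathEdge es ⟨
        map (renumber ρ) (mapMaybe S.pathEdge es) ∎

      mapMaybe-cycleWord-ι : mapMaybe L.cycleWord (map ιE es) ≡ mapMaybe S.cycleWord es
      mapMaybe-cycleWord-ι = begin
        mapMaybe L.cycleWord (map ιE es)
          ≡⟨ mapMaybe-map L.cycleWord ιE es ⟩
        mapMaybe (L.cycleWord ∘ ιE) es
          ≡⟨ mapMaybe-cong-∈ _ _ es (λ {e} e∈ → cycleWord-ι e (sources-inside e∈)) ⟩
        mapMaybe S.cycleWord es ∎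

IsPosition : ℕ → ℕ → Set
IsPosition n i = 1 ≤ i × i ≤ n

toℕ-IsPosition : ∀ {n i} (k : Fin n) → suc (toℕ k) ≡ i → IsPosition n i
toℕ-IsPosition k refl = s≤s z≤n , toℕ<n k

range-Unique : ∀ n → Unique (range n)
range-Unique n = Unique.map⁺ suc-injective (Unique.upTo⁺ n)

target∈endpoints : ∀ {A : Set} {i w j} (es : List (Edge A)) → (i , w , j) ∈ es → j ∈ endpoints es
target∈endpoints (_ ∷ es) (here refl) = there (here refl)
target∈endpoints (_ ∷ es) (there e∈) = there (there (target∈endpoints es e∈))

Unique-endpoints⇒in-degree≤1 : ∀ {A : Set} (es : List (Edge A)) → Unique (endpoints es) →
  ∀ {i w j i' w'} → (i , w , j) ∈ es → (i' , w' , j) ∈ es → i ≡ i'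
Unique-endpoints⇒in-degree≤1 (_ ∷ es) _ (here refl) (here refl) = refl
Unique-endpoints⇒in-degree≤1 (_ ∷ es) (_ ∷ j∉ ∷ _) (here refl) (there e∈) =
  contradiction refl (All.lookup j∉ (target∈endpoints es e∈))
Unique-endpoints⇒in-degree≤1 (_ ∷ es) (_ ∷ j∉ ∷ _) (there e∈) (here refl) =
  contradiction refl (All.lookup j∉ (target∈endpoints es e∈))
Unique-endpoints⇒in-degree≤1 (_ ∷ es) (_ ∷ _ ∷ u) (there e∈) (there e∈') =
  Unique-endpoints⇒in-degree≤1 es u e∈ e∈'

module ValidCowordism {A : Set} {X Y : Boundary} (c : Cowordism A X Y) where

  endpoints-IsPosition : ∀ {i w j} → (i , w , j) ∈ regular (word c) →
                         IsPosition (size Y + size X) i × IsPosition (size Y + size X) j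
  endpoints-IsPosition e∈ with All.lookup (proj₁ (valid c)) e∈
  ... | (k , k≡i , _) , (k' , k'≡j , _) = toℕ-IsPosition k k≡i , toℕ-IsPosition k' k'≡j

  in-degree≤1 : ∀ {i w j i' w'} → (i , w , j) ∈ regular (word c) → (i' , w' , j) ∈ regular (word c) → i ≡ i'
  in-degree≤1 = Unique-endpoints⇒in-degree≤1 (regular (word c))
    (Unique-resp-↭ (↭-sym (proj₂ (valid c))) (range-Unique _))

module ValidGluing {A : Set} {X Y Z : Boundary} (σ : Cowordism A X Y) (τ : Cowordism A Y Z) where
  open Compose Y Z (word τ) (word σ)
  open GluingGraph Y Z (word τ) (word σ)

  in-degree≤1 : ∀ {x x' w w' u} → (x , w , u) ∈ E → (x' , w' , u) ∈ E → x ≡ x'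
  in-degree≤1 e∈ e∈' with edgeOf e∈ | edgeOf e∈'
  ... | σ-edge i∈ | σ-edge i'∈ = cong vs (ValidCowordism.in-degree≤1 σ i∈ i'∈)
  ... | τ-edge i∈ | τ-edge i'∈ = cong vt (ValidCowordism.in-degree≤1 τ i∈ i'∈)

  targets-in-range : ∀ {x w u} → (x , w , u) ∈ E → InRange u
  targets-in-range e∈ with edgeOf e∈
  ... | σ-edge _ = tt
  ... | τ-edge j∈ = proj₂ (proj₂ (ValidCowordism.endpoints-IsPosition τ j∈))

  open Fuel in-degree≤1 targets-in-range public using (walk-saturated; cycleFrom-saturated)

module TensorOfComposites {A : Set} {X₁ Y₁ Z₁ X₂ Y₂ Z₂ : Boundary}
  (σ₁ : Cowordism A X₁ Y₁) (τ₁ : Cowordism A Y₁ Z₁)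
  (σ₂ : Cowordism A X₂ Y₂) (τ₂ : Cowordism A Y₂ Z₂) where

  private
    x₁ y₁ z₁ x₂ y₂ z₂ : ℕ
    x₁ = size X₁
    y₁ = size Y₁
    z₁ = size Z₁
    x₂ = size X₂
    y₂ = size Y₂
    z₂ = size Z₂

  σ⊗ τ⊗ : Multiword A
  σ⊗ = tensorM X₁ Y₁ X₂ Y₂ (word σ₁) (word σ₂)
  τ⊗ = tensorM Y₁ Z₁ Y₂ Z₂ (word τ₁) (word τ₂)

  module B = Compose (Y₁ ⊗B Y₂) (Z₁ ⊗B Z₂) τ⊗ σ⊗
  module C₁ = Compose Y₁ Z₁ (word τ₁) (word σ₁)
  module C₂ = Compose Y₂ Z₂ (word τ₂) (word σ₂)
  module G = GluingGraph (Y₁ ⊗B Y₂) (Z₁ ⊗B Z₂) τ⊗ σ⊗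
  module G₁ = GluingGraph Y₁ Z₁ (word τ₁) (word σ₁)
  module G₂ = GluingGraph Y₂ Z₂ (word τ₂) (word σ₂)

  -- ι₂ avoids the image of ι₁ only on these vertices
  Inside₂ : V → Set
  Inside₂ (vs i) = IsPosition (y₂ + x₂) i
  Inside₂ (vt j) = IsPosition (z₂ + y₂) j

  module Sim₁ = Simulation Y₁ Z₁ (Y₁ ⊗B Y₂) (Z₁ ⊗B Z₂) (word τ₁) (word σ₁) τ⊗ σ⊗
    (shiftAbove y₁ y₂ x₂) (shiftAbove z₁ z₂ y₂) (shiftAbove z₁ z₂ x₂)
    (shiftAbove-≤ᵇ y₁ y₂ x₂) (shiftAbove-injective z₁ z₂ y₂) (λ _ → ⊤)
  module Sim₂ = Simulation Y₂ Z₂ (Y₁ ⊗B Y₂) (Z₁ ⊗B Z₂) (word τ₂) (word σ₂) τ⊗ σ⊗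
    (y₁ +_) (z₁ +_) (z₁ +_)
    (λ a b → ≤ᵇ-cong (mk⇔ (+-cancelˡ-≤ y₁ a b) (+-monoʳ-≤ y₁))) (+-cancelˡ-≡ z₁ _ _) Inside₂

  σ-image₁ σ-image₂ τ-image₁ τ-image₂ : List B.GEdge
  σ-image₁ = map Sim₁.ιE G₁.σ-edges
  σ-image₂ = map Sim₂.ιE G₂.σ-edges
  τ-image₁ = map Sim₁.ιE G₁.τ-edges
  τ-image₂ = map Sim₂.ιE G₂.τ-edges

  B-edges : B.E ≡ (σ-image₁ ++ σ-image₂) ++ (τ-image₁ ++ τ-image₂)
  B-edges = cong₂ _++_
    (trans (map-++ _ (map _ (regular (word σ₁))) _)
      (cong₂ _++_ (map-∘-cong (regular (word σ₁)) (λ _ → refl)) (map-∘-cong (regular (word σ₂)) (λ _ → refl))))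
    (trans (map-++ _ (map _ (regular (word τ₁))) _)
      (cong₂ _++_ (map-∘-cong (regular (word τ₁)) (λ _ → refl)) (map-∘-cong (regular (word τ₂)) (λ _ → refl))))

  B-edges-↭ : B.E ↭ map Sim₁.ιE C₁.E ++ map Sim₂.ιE C₂.E
  B-edges-↭ = subst₂ _↭_ (sym B-edges)
    (cong₂ _++_ (sym (map-++ Sim₁.ιE G₁.σ-edges G₁.τ-edges)) (sym (map-++ Sim₂.ιE G₂.σ-edges G₂.τ-edges)))
    (↭-interchange σ-image₁ σ-image₂ τ-image₁ τ-image₂)

  sources-inside₂ : ∀ {e} → e ∈ C₂.E → Inside₂ (proj₁ e)
  sources-inside₂ e∈ with G₂.edgeOf e∈
  ... | G₂.σ-edge i∈ = proj₁ (ValidCowordism.endpoints-IsPosition σ₂ i∈)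
  ... | G₂.τ-edge i∈ = proj₁ (ValidCowordism.endpoints-IsPosition τ₂ i∈)

  targets-inside₂ : ∀ {x w u} → (x , w , u) ∈ C₂.E → Inside₂ u
  targets-inside₂ e∈ with G₂.edgeOf e∈
  ... | G₂.σ-edge j∈ = proj₂ (ValidCowordism.endpoints-IsPosition σ₂ j∈)
  ... | G₂.τ-edge j∈ = proj₂ (ValidCowordism.endpoints-IsPosition τ₂ j∈)

  ι₂≢ι₁ : ∀ {u} v → Inside₂ u → Sim₂.ι u ≢ Sim₁.ι v
  ι₂≢ι₁ {vs i} (vs i') (1≤i , i≤) e = c+≢shiftAbove y₁ y₂ x₂ i' 1≤i i≤ (vs-injective e)
  ι₂≢ι₁ {vt j} (vt j') (1≤j , j≤) e = c+≢shiftAbove z₁ z₂ y₂ j' 1≤j j≤ (vt-injective e)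
  ι₂≢ι₁ {vs i} (vt j') _ ()
  ι₂≢ι₁ {vt j} (vs i') _ ()

  outEdge-E-ι₁ : ∀ v → ⊤ → B.outEdge B.E (Sim₁.ι v) ≡ Maybe.map (map₂ Sim₁.ι) (C₁.outEdge C₁.E v)
  outEdge-E-ι₁ v _ = begin
    B.outEdge B.E (Sim₁.ι v)
      ≡⟨ cong (λ es → B.outEdge es (Sim₁.ι v)) B-edges ⟩
    B.outEdge ((σ-image₁ ++ σ-image₂) ++ (τ-image₁ ++ τ-image₂)) (Sim₁.ι v)
      ≡⟨ G.outEdge-interleaveˡ σ-image₁ σ-image₂ τ-image₁ τ-image₂ (Sim₁.ι v)
           (avoids G₂.σ-edges ∈-++⁺ˡ) (avoids G₂.τ-edges (∈-++⁺ʳ G₂.σ-edges)) ⟩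
    B.outEdge (σ-image₁ ++ τ-image₁) (Sim₁.ι v)
      ≡⟨ cong (λ es → B.outEdge es (Sim₁.ι v)) (map-++ Sim₁.ιE G₁.σ-edges G₁.τ-edges) ⟨
    B.outEdge (map Sim₁.ιE C₁.E) (Sim₁.ι v)
      ≡⟨ Sim₁.outEdge-ι C₁.E v ⟩
    Maybe.map (map₂ Sim₁.ι) (C₁.outEdge C₁.E v) ∎
    where
    open ≡-Reasoning
    avoids : ∀ es → es ⊆ C₂.E → B.outEdge (map Sim₂.ιE es) (Sim₁.ι v) ≡ nothing
    avoids es es⊆ = G.outEdge-map-∉ Sim₂.ιE es (Sim₁.ι v) (λ e∈ → ι₂≢ι₁ v (sources-inside₂ (es⊆ e∈)))

  outEdge-E-ι₂ : ∀ v → Inside₂ v → B.outEdge B.E (Sim₂.ι v) ≡ Maybe.map (map₂ Sim₂.ι) (C₂.outEdge C₂.E v)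
  outEdge-E-ι₂ v v-in = begin
    B.outEdge B.E (Sim₂.ι v)
      ≡⟨ cong (λ es → B.outEdge es (Sim₂.ι v)) B-edges ⟩
    B.outEdge ((σ-image₁ ++ σ-image₂) ++ (τ-image₁ ++ τ-image₂)) (Sim₂.ι v)
      ≡⟨ G.outEdge-interleaveʳ σ-image₁ σ-image₂ τ-image₁ τ-image₂ (Sim₂.ι v)
           (avoids G₁.σ-edges) (avoids G₁.τ-edges) ⟩
    B.outEdge (σ-image₂ ++ τ-image₂) (Sim₂.ι v)
      ≡⟨ cong (λ es → B.outEdge es (Sim₂.ι v)) (map-++ Sim₂.ιE G₂.σ-edges G₂.τ-edges) ⟨
    B.outEdge (map Sim₂.ιE C₂.E) (Sim₂.ι v)
      ≡⟨ Sim₂.outEdge-ι C₂.E v ⟩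
    Maybe.map (map₂ Sim₂.ι) (C₂.outEdge C₂.E v) ∎
    where
    open ≡-Reasoning
    avoids : ∀ es → B.outEdge (map Sim₁.ιE es) (Sim₂.ι v) ≡ nothing
    avoids es = G.outEdge-map-∉ Sim₁.ιE es (Sim₂.ι v) (λ {e} _ → ι₂≢ι₁ (proj₁ e) v-in ∘ sym)

  identified-ι₁ : ∀ v → B.identified (Sim₁.ι v) ≡ C₁.identified v
  identified-ι₁ (vs i) = ≤ᵇ-cong (shiftAbove≤c+p⇔ y₁ y₂ x₂ i)
  identified-ι₁ (vt j) = ≤ᵇ-cong (c+p<shiftAbove⇔ z₁ z₂ y₂ j)

  identified-ι₂ : ∀ v → B.identified (Sim₂.ι v) ≡ C₂.identified v
  identified-ι₂ (vs i) = ≤ᵇ-cong (mk⇔ (+-cancelˡ-≤ y₁ i y₂) (+-monoʳ-≤ y₁))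
  identified-ι₂ (vt j) = ≤ᵇ-cong (mk⇔ (+-cancelˡ-< z₁ z₂ j) (+-monoʳ-< z₁))

  partner-ι₁ : ∀ u → ⊤ → C₁.identified u ≡ true → B.partner (Sim₁.ι u) ≡ Sim₁.ι (C₁.partner u)
  partner-ι₁ (vs i) _ iu = cong vt (begin
    z₁ + z₂ + (y₁ + y₂) + 1 ∸ shiftAbove y₁ y₂ x₂ i
      ≡⟨ cong (z₁ + z₂ + (y₁ + y₂) + 1 ∸_) (shiftAbove-≤ y₁ y₂ x₂ i≤y₁) ⟩
    z₁ + z₂ + (y₁ + y₂) + 1 ∸ i
      ≡⟨ cong (_∸ i) (regroup z₁ z₂ y₁ y₂) ⟩
    (z₁ + y₁ + 1) + (z₂ + y₂) ∸ i
      ≡⟨ +-∸-comm (z₂ + y₂) i≤z₁+y₁+1 ⟩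
    (z₁ + y₁ + 1 ∸ i) + (z₂ + y₂)
      ≡⟨ +-assoc (z₁ + y₁ + 1 ∸ i) z₂ y₂ ⟨
    z₁ + y₁ + 1 ∸ i + z₂ + y₂
      ≡⟨ shiftAbove-> z₁ z₂ y₂ (≤ᵇ≡true⇒≤ {suc z₁} (G₁.identified-partner (vs i) iu)) ⟨
    shiftAbove z₁ z₂ y₂ (z₁ + y₁ + 1 ∸ i) ∎)
    where
    open ≡-Reasoning
    i≤y₁ : i ≤ y₁
    i≤y₁ = ≤ᵇ≡true⇒≤ iu
    i≤z₁+y₁+1 : i ≤ z₁ + y₁ + 1
    i≤z₁+y₁+1 = ≤-trans i≤y₁ (≤-trans (m≤n+m y₁ z₁) (m≤m+n (z₁ + y₁) 1))
    regroup : ∀ z₁ z₂ y₁ y₂ → z₁ + z₂ + (y₁ + y₂) + 1 ≡ (z₁ + y₁ + 1) + (z₂ + y₂)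
    regroup = solve-∀
  partner-ι₁ (vt j) _ iu = cong vs (begin
    z₁ + z₂ + (y₁ + y₂) + 1 ∸ shiftAbove z₁ z₂ y₂ j
      ≡⟨ cong (z₁ + z₂ + (y₁ + y₂) + 1 ∸_) (shiftAbove-> z₁ z₂ y₂ (≤ᵇ≡true⇒≤ {suc z₁} {j} iu)) ⟩
    z₁ + z₂ + (y₁ + y₂) + 1 ∸ (j + z₂ + y₂)
      ≡⟨ cong₂ _∸_ (regroup z₁ z₂ y₁ y₂) (rotate j z₂ y₂) ⟩
    (z₂ + y₂) + (z₁ + y₁ + 1) ∸ ((z₂ + y₂) + j)
      ≡⟨ [m+n]∸[m+o]≡n∸o (z₂ + y₂) (z₁ + y₁ + 1) j ⟩
    z₁ + y₁ + 1 ∸ j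
      ≡⟨ shiftAbove-≤ y₁ y₂ x₂ (≤ᵇ≡true⇒≤ (G₁.identified-partner (vt j) iu)) ⟨
    shiftAbove y₁ y₂ x₂ (z₁ + y₁ + 1 ∸ j) ∎)
    where
    open ≡-Reasoning
    regroup : ∀ z₁ z₂ y₁ y₂ → z₁ + z₂ + (y₁ + y₂) + 1 ≡ (z₂ + y₂) + (z₁ + y₁ + 1)
    regroup = solve-∀
    rotate : ∀ j z₂ y₂ → j + z₂ + y₂ ≡ (z₂ + y₂) + j
    rotate = solve-∀

  partner-ι₂ : ∀ u → Inside₂ u → C₂.identified u ≡ true → B.partner (Sim₂.ι u) ≡ Sim₂.ι (C₂.partner u)
  partner-ι₂ (vs i) _ iu = cong vt (begin
    z₁ + z₂ + (y₁ + y₂) + 1 ∸ (y₁ + i)   ≡⟨ cong (_∸ (y₁ + i)) (regroup z₁ z₂ y₁ y₂) ⟩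
    y₁ + (z₁ + (z₂ + y₂ + 1)) ∸ (y₁ + i) ≡⟨ [m+n]∸[m+o]≡n∸o y₁ (z₁ + (z₂ + y₂ + 1)) i ⟩
    z₁ + (z₂ + y₂ + 1) ∸ i               ≡⟨ +-∸-assoc z₁ i≤z₂+y₂+1 ⟩
    z₁ + (z₂ + y₂ + 1 ∸ i)               ∎)
    where
    open ≡-Reasoning
    i≤z₂+y₂+1 : i ≤ z₂ + y₂ + 1
    i≤z₂+y₂+1 = ≤-trans (≤ᵇ≡true⇒≤ {i} {y₂} iu) (≤-trans (m≤n+m y₂ z₂) (m≤m+n (z₂ + y₂) 1))
    regroup : ∀ z₁ z₂ y₁ y₂ → z₁ + z₂ + (y₁ + y₂) + 1 ≡ y₁ + (z₁ + (z₂ + y₂ + 1))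
    regroup = solve-∀
  partner-ι₂ (vt j) (_ , j≤z₂+y₂) _ = cong vs (begin
    z₁ + z₂ + (y₁ + y₂) + 1 ∸ (z₁ + j)   ≡⟨ cong (_∸ (z₁ + j)) (regroup z₁ z₂ y₁ y₂) ⟩
    z₁ + (y₁ + (z₂ + y₂ + 1)) ∸ (z₁ + j) ≡⟨ [m+n]∸[m+o]≡n∸o z₁ (y₁ + (z₂ + y₂ + 1)) j ⟩
    y₁ + (z₂ + y₂ + 1) ∸ j               ≡⟨ +-∸-assoc y₁ (≤-trans j≤z₂+y₂ (m≤m+n (z₂ + y₂) 1)) ⟩
    y₁ + (z₂ + y₂ + 1 ∸ j)               ∎)
    where
    open ≡-Reasoning
    regroup : ∀ z₁ z₂ y₁ y₂ → z₁ + z₂ + (y₁ + y₂) + 1 ≡ z₁ + (y₁ + (z₂ + y₂ + 1))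
    regroup = solve-∀

  outer-ι₁ : ∀ v → C₁.identified v ≡ false → B.outer (Sim₁.ι v) ≡ shiftAbove z₁ z₂ x₂ (C₁.outer v)
  outer-ι₁ (vt j) ia = trans (shiftAbove-≤ z₁ z₂ y₂ j≤z₁) (sym (shiftAbove-≤ z₁ z₂ x₂ j≤z₁))
    where
    j≤z₁ : j ≤ z₁
    j≤z₁ = ≤-pred (≤ᵇ≡false⇒> {suc z₁} {j} ia)
  outer-ι₁ (vs i) ia = begin
    z₁ + z₂ + (shiftAbove y₁ y₂ x₂ i ∸ (y₁ + y₂))
      ≡⟨ cong (λ n → z₁ + z₂ + (n ∸ (y₁ + y₂))) (shiftAbove-> y₁ y₂ x₂ y₁<i) ⟩
    z₁ + z₂ + (i + y₂ + x₂ ∸ (y₁ + y₂))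
      ≡⟨ cong (λ n → z₁ + z₂ + (n + y₂ + x₂ ∸ (y₁ + y₂))) (m+[n∸m]≡n (<⇒≤ y₁<i)) ⟨
    z₁ + z₂ + (y₁ + d + y₂ + x₂ ∸ (y₁ + y₂))
      ≡⟨ cong (λ n → z₁ + z₂ + (n ∸ (y₁ + y₂))) (regroup y₁ d y₂ x₂) ⟩
    z₁ + z₂ + ((y₁ + y₂) + (d + x₂) ∸ (y₁ + y₂))
      ≡⟨ cong (z₁ + z₂ +_) (m+n∸m≡n (y₁ + y₂) (d + x₂)) ⟩
    z₁ + z₂ + (d + x₂)
      ≡⟨ regroup′ z₁ z₂ d x₂ ⟩
    z₁ + d + z₂ + x₂
      ≡⟨ shiftAbove-> z₁ z₂ x₂ (m<m+n z₁ (m<n⇒0<n∸m y₁<i)) ⟨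
    shiftAbove z₁ z₂ x₂ (z₁ + d) ∎
    where
    open ≡-Reasoning
    y₁<i : y₁ < i
    y₁<i = ≤ᵇ≡false⇒> ia
    d : ℕ
    d = i ∸ y₁
    regroup : ∀ y₁ d y₂ x₂ → y₁ + d + y₂ + x₂ ≡ (y₁ + y₂) + (d + x₂)
    regroup = solve-∀
    regroup′ : ∀ z₁ z₂ d x₂ → z₁ + z₂ + (d + x₂) ≡ z₁ + d + z₂ + x₂
    regroup′ = solve-∀

  outer-ι₂ : ∀ v → C₂.identified v ≡ false → B.outer (Sim₂.ι v) ≡ z₁ + C₂.outer v
  outer-ι₂ (vt j) _ = refl
  outer-ι₂ (vs i) _ = trans (cong (z₁ + z₂ +_) ([m+n]∸[m+o]≡n∸o y₁ i y₂)) (+-assoc z₁ z₂ (i ∸ y₂))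

  partner-inside₂ : ∀ {u} → Inside₂ u → C₂.identified u ≡ true → Inside₂ (C₂.partner u)
  partner-inside₂ {vs i} (1≤i , _) iu =
    ≤-trans (s≤s z≤n) (≤ᵇ≡true⇒≤ {suc z₂} (G₂.identified-partner (vs i) iu)) ,
    ≤-trans (∸-monoʳ-≤ (z₂ + y₂ + 1) 1≤i) (≤-reflexive (m+n∸n≡m (z₂ + y₂) 1))
  partner-inside₂ {vt j} (_ , j≤z₂+y₂) iu =
    ≤-trans (≤-reflexive (sym (m+n∸m≡n (z₂ + y₂) 1))) (∸-monoʳ-≤ (z₂ + y₂ + 1) j≤z₂+y₂) ,
    ≤-trans (≤ᵇ≡true⇒≤ (G₂.identified-partner (vt j) iu)) (m≤m+n y₂ x₂)

  simulation₁ : Sim₁.IsSimulation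
  simulation₁ = record
    { outEdge-E-ι    = outEdge-E-ι₁
    ; identified-ι   = identified-ι₁
    ; partner-ι      = partner-ι₁
    ; outer-ι        = outer-ι₁
    ; target-inside  = λ _ → tt
    ; partner-inside = λ _ _ → tt
    }

  simulation₂ : Sim₂.IsSimulation
  simulation₂ = record
    { outEdge-E-ι    = outEdge-E-ι₂
    ; identified-ι   = identified-ι₂
    ; partner-ι      = partner-ι₂
    ; outer-ι        = outer-ι₂
    ; target-inside  = λ {v} eq → targets-inside₂ (G₂.outEdge-∈ C₂.E v eq)
    ; partner-inside = partner-inside₂
    }

  module V₁ = ValidGluing σ₁ τ₁
  module V₂ = ValidGluing σ₂ τ₂

  length-B : length B.E ≡ length C₁.E + length C₂.E
  length-B = begin
    length B.E
      ≡⟨ ↭-length B-edges-↭ ⟩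
    length (map Sim₁.ιE C₁.E ++ map Sim₂.ιE C₂.E)
      ≡⟨ length-++ (map Sim₁.ιE C₁.E) ⟩
    length (map Sim₁.ιE C₁.E) + length (map Sim₂.ιE C₂.E)
      ≡⟨ cong₂ _+_ (length-map Sim₁.ιE C₁.E) (length-map Sim₂.ιE C₂.E) ⟩
    length C₁.E + length C₂.E ∎
    where open ≡-Reasoning

  C₁-shorter : length C₁.E ≤ length B.E
  C₁-shorter = subst (length C₁.E ≤_) (sym length-B) (m≤m+n (length C₁.E) (length C₂.E))

  C₂-shorter : length C₂.E ≤ length B.E
  C₂-shorter = subst (length C₂.E ≤_) (sym length-B) (m≤n+m (length C₂.E) (length C₁.E))

  module T₁ = Sim₁.Transport simulation₁
    (λ a ia → V₁.walk-saturated a ia C₁-shorter) (λ a → V₁.cycleFrom-saturated a C₁-shorter)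
  module T₂ = Sim₂.Transport simulation₂
    (λ a ia → V₂.walk-saturated a ia C₂-shorter) (λ a → V₂.cycleFrom-saturated a C₂-shorter)

  regular-↭ : regular B.result ↭ regular (tensorM X₁ Z₁ X₂ Z₂ C₁.result C₂.result)
  regular-↭ = ↭-trans (mapMaybe-↭ B.pathEdge B-edges-↭) (↭-reflexive (begin
    mapMaybe B.pathEdge (map Sim₁.ιE C₁.E ++ map Sim₂.ιE C₂.E)
      ≡⟨ mapMaybe-++ B.pathEdge (map Sim₁.ιE C₁.E) (map Sim₂.ιE C₂.E) ⟩
    mapMaybe B.pathEdge (map Sim₁.ιE C₁.E) ++ mapMaybe B.pathEdge (map Sim₂.ιE C₂.E)
      ≡⟨ cong₂ _++_
           (T₁.mapMaybe-pathEdge-ι C₁.E (λ _ → tt)) (T₂.mapMaybe-pathEdge-ι C₂.E sources-inside₂) ⟩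
    map (renumber (shiftAbove z₁ z₂ x₂)) (regular C₁.result) ++ map (renumber (z₁ +_)) (regular C₂.result)
      ≡⟨ cong₂ _++_ (map-cong (λ _ → refl) (regular C₁.result)) (map-cong (λ _ → refl) (regular C₂.result)) ⟩
    regular (tensorM X₁ Z₁ X₂ Z₂ C₁.result C₂.result) ∎))
    where open ≡-Reasoning

  cycles-↭ : mapMaybe B.cycleWord B.E ↭ mapMaybe C₁.cycleWord C₁.E ++ mapMaybe C₂.cycleWord C₂.E
  cycles-↭ = ↭-trans (mapMaybe-↭ B.cycleWord B-edges-↭) (↭-reflexive (trans
    (mapMaybe-++ B.cycleWord (map Sim₁.ιE C₁.E) (map Sim₂.ιE C₂.E))
    (cong₂ _++_ (T₁.mapMaybe-cycleWord-ι C₁.E (λ _ → tt)) (T₂.mapMaybe-cycleWord-ι C₂.E sources-inside₂))))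

  singular-↭ : singular B.result ↭ singular (tensorM X₁ Z₁ X₂ Z₂ C₁.result C₂.result)
  singular-↭ = ↭-trans
    (++⁺ˡ (singular (word σ₁) ++ singular (word σ₂)) (++⁺ˡ (singular (word τ₁) ++ singular (word τ₂)) cycles-↭))
    (↭-interchange₃ (singular (word σ₁)) (singular (word σ₂)) (singular (word τ₁)) (singular (word τ₂))
                    (mapMaybe C₁.cycleWord C₁.E) (mapMaybe C₂.cycleWord C₂.E))

  composite-of-tensors : B.result ≈M tensorM X₁ Z₁ X₂ Z₂ C₁.result C₂.result
  composite-of-tensors = regular-↭ , ↭⇒cyclic-↭ singular-↭

mainTheorem5 : (k : ℕ) (X₁ Y₁ Z₁ X₂ Y₂ Z₂ : Boundary)
    (σ₁ : Cowordism (Fin k) X₁ Y₁) (τ₁ : Cowordism (Fin k) Y₁ Z₁)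
    (σ₂ : Cowordism (Fin k) X₂ Y₂) (τ₂ : Cowordism (Fin k) Y₂ Z₂) →
    composeM (Y₁ ⊗B Y₂) (Z₁ ⊗B Z₂)
      (tensorM Y₁ Z₁ Y₂ Z₂ (word τ₁) (word τ₂))
      (tensorM X₁ Y₁ X₂ Y₂ (word σ₁) (word σ₂))
    ≈M
    tensorM X₁ Z₁ X₂ Z₂ (composeM Y₁ Z₁ (word τ₁) (word σ₁)) (composeM Y₂ Z₂ (word τ₂) (word σ₂))
mainTheorem5 k X₁ Y₁ Z₁ X₂ Y₂ Z₂ σ₁ τ₁ σ₂ τ₂ = TensorOfComposites.composite-of-tensors σ₁ τ₁ σ₂ τ₂
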